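{- Let $T$ be a perfect binary tree of height $H \ge 1$. For each level $\ell \in \{0,1,\dots,H\}$ (the root being at level $0$ and the leaves at level $H$), index the $2^\ell$ nodes of level $\ell$ from left to right by positions $0,1,\dots,2^\ell-1$, and write $\mathrm{pos}(x)$ for the position of a node $x$ within its level. For a node $v$ at level $\ell$, its routing table consists of all nodes $u$ at the same level $\ell$ with $\mathrm{pos}(u) = \mathrm{pos}(v) \pm 2^{k}$ for some integer $k \ge 0$ (only those positions lying in $\{0,\dots,2^\ell-1\}$). For a node $x$ at level $\ell$, its left (resp. right) sibling is the node at level $\ell$ with position $\mathrm{pos}(x)-1$ (resp. $\mathrm{pos}(x)+1$), if such a node exists. Then: (i) If a node $v$ contains $u$ in its routing table and $u$ and $v$ do not have the same parent, then the parent of $v$ contains the parent of $u$ in its routing table. (ii) If a node $v$ contains $u$ in its routing table, then the left (resp. right) sibling of $v$ contains the left (resp. right) sibling of $u$ in its routing table, whenever both of these siblings exist. (iii) Every non-leaf node of $T$ has two adjacent nodes in the in-order traversal of $T$ (its in-order predecessor and its in-order successor), and both of them are leaves.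
   Context: This concerns the upper level of the D$^3$-Tree overlay, which is a perfect binary tree (all leaves at the same depth, every internal node having exactly two children). Each node stores links to nodes of its own level at exponentially increasing distances $2^0, 2^1, 2^2, \dots$ to the left and to the right; these links form its routing table. "Adjacent nodes in the in-order traversal" means the immediate predecessor and successor of the node in the symmetric (left subtree, node, right subtree) ordering of $T$. -}

module Defs where

open import Data.Nat using (ℕ; zero; suc; _+_; _*_; _^_; _<_; _≤_)
open import Data.Nat.DivMod using (_/_)
open import Data.Product using (_×_; _,_; ∃-syntax; proj₁)
open import Data.Sum using (_⊎_)
open import Data.List using (List; _∷_; []; _++_)
open import Relation.Binary.PropositionalEquality using (_≡_; _≢_)

-- A node of the perfect binary tree is identified by (level , position);
-- positions on level ℓ range over 0 .. 2^ℓ - 1, ordered left to right.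
Node : Set
Node = ℕ × ℕ

level : Node → ℕ
level = proj₁

IsNode : ℕ → Node → Set
IsNode H (ℓ , p) = ℓ ≤ H × p < 2 ^ ℓ

-- Children of (ℓ , p) are (ℓ+1 , 2p) (left) and (ℓ+1 , 2p+1) (right);
-- hence the parent of a node at position p on level ℓ+1 has position p / 2.
parentPos : ℕ → ℕ
parentPos p = p / 2

InRT : ℕ → ℕ → ℕ → Set
InRT ℓ v u = u < 2 ^ ℓ × ∃[ k ] (u + 2 ^ k ≡ v ⊎ v + 2 ^ k ≡ u)

inorderSub : ℕ → ℕ → ℕ → List Node
inorderSub zero    ℓ p = (ℓ , p) ∷ []
inorderSub (suc d) ℓ p =
  inorderSub d (suc ℓ) (2 * p) ++ ((ℓ , p) ∷ inorderSub d (suc ℓ) (2 * p + 1))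

inorder : ℕ → List Node
inorder H = inorderSub H 0 0

module Submission where

-- Positions on a level are natural numbers and the parent of
-- position p is p / 2, so parts (i) and (ii) are arithmetic facts about
-- jumps by powers of two:
--   (i)  halving sends a jump a + 2^k = b to a jump by 2^(k-1) when k ≥ 1,
--        and when k = 0 the halves either coincide or differ by 2^0;
--   (ii) the routing-table relation is invariant under translating both
--        positions by the same amount s (we use s = 1 in both directions).  We call a node t
-- "flanked by P" in a list when it occurs with immediate neighbours that
-- both satisfy P.  Every subtree traversal starts and ends with a leaf, so
-- the root of a subtree of positive depth is flanked by leaves; flankedness
-- survives embedding a subtree's traversal into its parent's.  Descending
-- from the root along the binary expansion of the position then shows that
-- every internal node is flanked by leaves in the whole traversal.

open import Defs
open import Data.Nat using (ℕ; zero; suc; _+_; _*_; _^_; _<_; _≤_; _∸_; s≤s; z≤n; _≤?_)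
open import Data.Nat.DivMod using (_/_; m/n≡1+[m∸n]/n; +-distrib-/-∣ʳ; m*n/n≡m; m<n*o⇒m/o<n)
open import Data.Nat.Divisibility using (divides)
open import Data.Nat.Properties
open import Data.Nat.Solver using (module +-*-Solver)
open import Data.Product using (_×_; _,_; ∃-syntax)
open import Data.Sum using (_⊎_; inj₁; inj₂)
open import Data.List using (List; _∷_; []; _++_)
open import Data.List.Properties using (++-assoc)
open import Data.Empty using (⊥-elim)
open import Relation.Nullary using (yes; no)
open import Relation.Binary.PropositionalEquality
  using (_≡_; _≢_; refl; sym; trans; cong; cong₂; subst; module ≡-Reasoning)

half-+2 : ∀ u → (2 + u) / 2 ≡ suc (u / 2)
half-+2 u = m/n≡1+[m∸n]/n {2 + u} {2} (s≤s (s≤s z≤n))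

half-suc : ∀ u → suc u / 2 ≡ u / 2 ⊎ suc u / 2 ≡ suc (u / 2)
half-suc zero                = inj₁ refl
half-suc (suc zero)          = inj₂ refl
half-suc (suc (suc u)) with half-suc u
... | inj₁ e = inj₁ (trans (half-+2 (suc u)) (trans (cong suc e) (sym (half-+2 u))))
... | inj₂ e = inj₂ (trans (half-+2 (suc u)) (cong suc (trans e (sym (half-+2 u)))))

half-+2^suc : ∀ a k → (a + 2 ^ suc k) / 2 ≡ a / 2 + 2 ^ k
half-+2^suc a k = begin
  (a + 2 ^ suc k) / 2   ≡⟨ +-distrib-/-∣ʳ a (divides (2 ^ k) (*-comm 2 (2 ^ k))) ⟩
  a / 2 + 2 ^ suc k / 2 ≡⟨ cong (λ x → a / 2 + x / 2) (*-comm 2 (2 ^ k)) ⟩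
  a / 2 + 2 ^ k * 2 / 2 ≡⟨ cong (a / 2 +_) (m*n/n≡m (2 ^ k) 2) ⟩
  a / 2 + 2 ^ k         ∎
  where open ≡-Reasoning

half-jump : ∀ a b k → a + 2 ^ k ≡ b → a / 2 ≢ b / 2 → ∃[ j ] a / 2 + 2 ^ j ≡ b / 2
half-jump a b zero a+1≡b a≢b with half-suc a
... | inj₁ same = ⊥-elim (a≢b (trans (sym same) (cong (_/ 2) (trans (+-comm 1 a) a+1≡b))))
... | inj₂ next = 0 , trans (+-comm (a / 2) 1) (trans (sym next) (cong (_/ 2) (trans (+-comm 1 a) a+1≡b)))
half-jump a b (suc k) a+2^k≡b _ = k , trans (sym (half-+2^suc a k)) (cong (_/ 2) a+2^k≡b)

parent-bound : ∀ ℓ u → u < 2 ^ suc ℓ → parentPos u < 2 ^ ℓ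
parent-bound ℓ u u< = m<n*o⇒m/o<n (subst (u <_) (*-comm 2 (2 ^ ℓ)) u<)

parent-inRT : ∀ ℓ u v → InRT (suc ℓ) v u → parentPos u ≢ parentPos v →
              InRT ℓ (parentPos v) (parentPos u)
parent-inRT ℓ u v (u< , k , inj₁ u+2^k≡v) u≢v with half-jump u v k u+2^k≡v u≢v
... | j , e = parent-bound ℓ u u< , j , inj₁ e
parent-inRT ℓ u v (u< , k , inj₂ v+2^k≡u) u≢v with half-jump v u k v+2^k≡u (λ e → u≢v (sym e))
... | j , e = parent-bound ℓ u u< , j , inj₂ e

inRT-shift : ∀ ℓ s u v → InRT ℓ v u → s + u < 2 ^ ℓ → InRT ℓ (s + v) (s + u)
inRT-shift ℓ s u v (_ , k , inj₁ e) s+u< = s+u< , k , inj₁ (trans (+-assoc s u (2 ^ k)) (cong (s +_) e))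
inRT-shift ℓ s u v (_ , k , inj₂ e) s+u< = s+u< , k , inj₂ (trans (+-assoc s v (2 ^ k)) (cong (s +_) e))

inRT-unshift : ∀ ℓ s u v → InRT ℓ (s + v) (s + u) → InRT ℓ v u
inRT-unshift ℓ s u v (s+u< , k , jump) = ≤-<-trans (m≤n+m u s) s+u< , k , cancel jump
  where
  cancel : ∀ {x y} → s + x + 2 ^ k ≡ s + y ⊎ s + y + 2 ^ k ≡ s + x →
                     x + 2 ^ k ≡ y ⊎ y + 2 ^ k ≡ x
  cancel {x} (inj₁ e) = inj₁ (+-cancelˡ-≡ s _ _ (trans (sym (+-assoc s x (2 ^ k))) e))
  cancel {_} {y} (inj₂ e) = inj₂ (+-cancelˡ-≡ s _ _ (trans (sym (+-assoc s y (2 ^ k))) e))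

Flanked : {A : Set} → (A → Set) → A → List A → Set
Flanked P t zs = ∃[ xs ] ∃[ ys ] ∃[ a ] ∃[ b ] (zs ≡ xs ++ (a ∷ t ∷ b ∷ ys) × P a × P b)

module _ {A : Set} {P : A → Set} {t : A} where

  flanked-++ʳ : ∀ xs ys → Flanked P t xs → Flanked P t (xs ++ ys)
  flanked-++ʳ _ zs (xs , ys , a , b , refl , Pa , Pb) =
    xs , ys ++ zs , a , b , ++-assoc xs (a ∷ t ∷ b ∷ ys) zs , Pa , Pb

  flanked-++ˡ : ∀ xs ys → Flanked P t ys → Flanked P t (xs ++ ys)
  flanked-++ˡ ws _ (xs , ys , a , b , refl , Pa , Pb) =
    ws ++ xs , ys , a , b , sym (++-assoc ws xs (a ∷ t ∷ b ∷ ys)) , Pa , Pb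

  flanked-≡ : ∀ {t' zs} → t ≡ t' → Flanked P t zs → Flanked P t' zs
  flanked-≡ refl fl = fl

  flanked-join : ∀ xs a ys b → P a → P b → Flanked P t ((xs ++ a ∷ []) ++ t ∷ b ∷ ys)
  flanked-join xs a ys b Pa Pb = xs , ys , a , b , ++-assoc xs (a ∷ []) (t ∷ b ∷ ys) , Pa , Pb

AtLevel : ℕ → Node → Set
AtLevel h x = level x ≡ h

inorder-first : ∀ d ℓ p → ∃[ a ] ∃[ ys ] (inorderSub d ℓ p ≡ a ∷ ys × AtLevel (ℓ + d) a)
inorder-first zero ℓ p = (ℓ , p) , [] , refl , sym (+-identityʳ ℓ)
inorder-first (suc d) ℓ p with inorder-first d (suc ℓ) (2 * p)
... | a , ys , eq , leaf =
  a , ys ++ (ℓ , p) ∷ inorderSub d (suc ℓ) (2 * p + 1) ,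
  cong (_++ (ℓ , p) ∷ inorderSub d (suc ℓ) (2 * p + 1)) eq ,
  trans leaf (sym (+-suc ℓ d))

inorder-last : ∀ d ℓ p → ∃[ xs ] ∃[ a ] (inorderSub d ℓ p ≡ xs ++ a ∷ [] × AtLevel (ℓ + d) a)
inorder-last zero ℓ p = [] , (ℓ , p) , refl , sym (+-identityʳ ℓ)
inorder-last (suc d) ℓ p with inorder-last d (suc ℓ) (2 * p + 1)
... | xs , a , eq , leaf =
  inorderSub d (suc ℓ) (2 * p) ++ (ℓ , p) ∷ xs , a ,
  trans (cong (λ zs → inorderSub d (suc ℓ) (2 * p) ++ (ℓ , p) ∷ zs) eq)
        (sym (++-assoc (inorderSub d (suc ℓ) (2 * p)) ((ℓ , p) ∷ xs) (a ∷ []))) ,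
  trans leaf (sym (+-suc ℓ d))

root-flanked : ∀ d ℓ p → Flanked (AtLevel (ℓ + suc d)) (ℓ , p) (inorderSub (suc d) ℓ p)
root-flanked d ℓ p with inorder-last d (suc ℓ) (2 * p) | inorder-first d (suc ℓ) (2 * p + 1)
... | xs , a , eq-left , leafa | b , ys , eq-right , leafb =
  subst (Flanked _ (ℓ , p)) (sym (cong₂ (λ L R → L ++ (ℓ , p) ∷ R) eq-left eq-right))
        (flanked-join xs a ys b (trans leafa (sym (+-suc ℓ d))) (trans leafb (sym (+-suc ℓ d))))

flanked-left : ∀ d ℓ p t → Flanked (AtLevel (suc ℓ + d)) t (inorderSub d (suc ℓ) (2 * p)) →
               Flanked (AtLevel (ℓ + suc d)) t (inorderSub (suc d) ℓ p)
flanked-left d ℓ p t fl rewrite +-suc ℓ d =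
  flanked-++ʳ (inorderSub d (suc ℓ) (2 * p)) _ fl

flanked-right : ∀ d ℓ p t → Flanked (AtLevel (suc ℓ + d)) t (inorderSub d (suc ℓ) (2 * p + 1)) →
                Flanked (AtLevel (ℓ + suc d)) t (inorderSub (suc d) ℓ p)
flanked-right d ℓ p t fl rewrite +-suc ℓ d =
  flanked-++ˡ (inorderSub d (suc ℓ) (2 * p)) _ (flanked-++ˡ ((ℓ , p) ∷ []) _ fl)

-- The descendant at relative depth j+1 and offset q of node p lies, on
-- the next level, below child 2p (if q < 2^j) or child 2p+1 (otherwise).
offset-split : ∀ j p q → q < 2 ^ suc j →
  (q < 2 ^ j × 2 ^ suc j * p + q ≡ 2 ^ j * (2 * p) + q)
  ⊎ ∃[ r ] (r < 2 ^ j × 2 ^ suc j * p + q ≡ 2 ^ j * (2 * p + 1) + r)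
offset-split j p q q< with 2 ^ j ≤? q
... | no  q≱ = inj₁ (≰⇒> q≱ , cong (_+ q) (left-child (2 ^ j) p))
  where
  open +-*-Solver
  left-child : ∀ x p → 2 * x * p ≡ x * (2 * p)
  left-child = solve 2 (λ x p → (con 2 :* x) :* p := x :* (con 2 :* p)) refl
... | yes q≥ = inj₂ (q ∸ 2 ^ j , r< , positions)
  where
  open +-*-Solver
  q≡ : 2 ^ j + (q ∸ 2 ^ j) ≡ q
  q≡ = m+[n∸m]≡n q≥
  r< : q ∸ 2 ^ j < 2 ^ j
  r< = +-cancelˡ-< (2 ^ j) (q ∸ 2 ^ j) (2 ^ j)
         (subst (_< 2 ^ j + 2 ^ j) (sym q≡) (subst (q <_) (cong (2 ^ j +_) (+-identityʳ (2 ^ j))) q<))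
  right-child : ∀ x p r → 2 * x * p + (x + r) ≡ x * (2 * p + 1) + r
  right-child = solve 3 (λ x p r → (con 2 :* x) :* p :+ (x :+ r) := x :* (con 2 :* p :+ con 1) :+ r) refl
  positions : 2 ^ suc j * p + q ≡ 2 ^ j * (2 * p + 1) + (q ∸ 2 ^ j)
  positions = trans (cong (2 ^ suc j * p +_) (sym q≡)) (right-child (2 ^ j) p (q ∸ 2 ^ j))

-- Every node strictly above the leaves of a subtree (relative depth j < d,
-- offset q < 2^j below the subtree root p) is flanked by leaves in the
-- subtree's traversal.
descendant-flanked : ∀ d j ℓ p q → j < d → q < 2 ^ j →
  Flanked (AtLevel (ℓ + d)) (j + ℓ , 2 ^ j * p + q) (inorderSub d ℓ p)
descendant-flanked (suc d) zero ℓ p zero _ _ =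
  flanked-≡ (cong (ℓ ,_) (sym (trans (+-identityʳ (1 * p)) (*-identityˡ p))))
            (root-flanked d ℓ p)
descendant-flanked (suc d) zero ℓ p (suc q) _ (s≤s ())
descendant-flanked (suc d) (suc j) ℓ p q (s≤s j<d) q< with offset-split j p q q<
... | inj₁ (q<' , pos) =
  flanked-left d ℓ p _ (flanked-≡ (cong₂ _,_ (+-suc j ℓ) (sym pos))
                              (descendant-flanked d j (suc ℓ) (2 * p) q j<d q<'))
... | inj₂ (r , r< , pos) =
  flanked-right d ℓ p _ (flanked-≡ (cong₂ _,_ (+-suc j ℓ) (sym pos))
                               (descendant-flanked d j (suc ℓ) (2 * p + 1) r j<d r<))

internal-flanked : ∀ H ℓ p → ℓ < H → p < 2 ^ ℓ → Flanked (AtLevel H) (ℓ , p) (inorder H)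
internal-flanked H ℓ p ℓ<H p< =
  simplify (descendant-flanked H ℓ 0 0 p ℓ<H p<)
  where
  simplify : Flanked (AtLevel (0 + H)) (ℓ + 0 , 2 ^ ℓ * 0 + p) (inorder H) →
             Flanked (AtLevel H) (ℓ , p) (inorder H)
  simplify fl rewrite +-identityʳ ℓ | *-zeroʳ (2 ^ ℓ) = fl

lemma1 : (H : ℕ) → 1 ≤ H →
    ((ℓ u v : ℕ) → suc ℓ ≤ H → v < 2 ^ suc ℓ →
       InRT (suc ℓ) v u → parentPos u ≢ parentPos v →
       InRT ℓ (parentPos v) (parentPos u))
    ×
    ((ℓ u v : ℕ) → ℓ ≤ H → v < 2 ^ ℓ → InRT ℓ v u →
       ((u' v' : ℕ) → suc u' ≡ u → suc v' ≡ v → InRT ℓ v' u')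
       ×
       (suc u < 2 ^ ℓ → suc v < 2 ^ ℓ → InRT ℓ (suc v) (suc u)))
    ×
    ((ℓ p : ℕ) → ℓ < H → p < 2 ^ ℓ →
       ∃[ xs ] ∃[ ys ] ∃[ a ] ∃[ b ]
         (inorder H ≡ xs ++ (a ∷ (ℓ , p) ∷ b ∷ ys)
          × level a ≡ H × level b ≡ H))
-- (i) and (ii) hold for all positions.
lemma1 H _ =
  (λ ℓ u v _ _ → parent-inRT ℓ u v) ,
  (λ ℓ u v _ _ inRT →
     (λ { u' v' refl refl → inRT-unshift ℓ 1 u' v' inRT }) ,
     (λ su< _ → inRT-shift ℓ 1 u v inRT su<)) ,
  internal-flanked H
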